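{- For any integers $k\geq m\geq 1$ and $n\geq l\geq k+1$, the number $op_{n,\geq k,\leq l}^m$ of ordered preference sets $(a_1,\dots,a_n)$ of length $n$ with at least $k$ flaws, leading term $a_1=m$, and $a_i\leq l$ for all $i$ equals $\binom{n+l-m-1}{l-k-2}$.
   Context: Parking model: $n$ parking spaces numbered $1,\dots,n$ from left to right; a preference set of length $n$ is a sequence $(a_1,\dots,a_n)$ with $a_i\in[n]$. Cars arrive in order; car $i$ goes to space $a_i$, and if it is occupied, moves to the first unoccupied space to the right; if there is none, the car cannot park. The number of flaws is the number of cars that cannot park. A preference set is ordered if $a_1\leq\cdots\leq a_n$; its leading term is $a_1$. Binomial coefficients with negative lower index are $0$. -}

module Defs where

open import Data.Nat using (ℕ; zero; suc; _+_; _∸_; _≤_; _≤?_; _≡ᵇ_)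
open import Data.Nat.Combinatorics using (_C_)
open import Data.Integer using (ℤ; +_; -[1+_])
open import Data.Bool using (Bool; true; false; if_then_else_; _∨_)
open import Data.Maybe using (Maybe; just; nothing)
open import Data.List using (List; []; _∷_; map; concatMap; upTo; length; filter; head)
open import Data.List.Relation.Unary.All using (All)
open import Data.List.Relation.Unary.Linked using (Linked)
open import Relation.Binary.PropositionalEquality using (_≡_)
open import Data.Product using (_×_)

binomℤ : ℕ → ℤ → ℕ
binomℤ a (+ j)     = a C j
binomℤ a -[1+ _ ]  = 0

range : ℕ → ℕ → List ℕ
range a b = map (λ i → a + i) (upTo (suc b ∸ a))

allSeqs : ℕ → ℕ → List (List ℕ)
allSeqs zero      bound = [] ∷ []
allSeqs (suc len) bound =
  concatMap (λ x → map (x ∷_) (allSeqs len bound)) (range 1 bound)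

PrefSets : ℕ → List (List ℕ)
PrefSets n = allSeqs n n

elemᵇ : ℕ → List ℕ → Bool
elemᵇ x []       = false
elemᵇ x (y ∷ ys) = (x ≡ᵇ y) ∨ elemᵇ x ys

firstNotIn : List ℕ → List ℕ → Maybe ℕ
firstNotIn occ []       = nothing
firstNotIn occ (s ∷ ss) = if elemᵇ s occ then firstNotIn occ ss else just s

parkSpot : ℕ → List ℕ → ℕ → Maybe ℕ
parkSpot n occ a = firstNotIn occ (range a n)

-- number of flaws (cars that cannot park), starting from occupied spots occ
flawsFrom : ℕ → List ℕ → List ℕ → ℕ
flawsFrom n occ []       = 0
flawsFrom n occ (a ∷ as) with parkSpot n occ a
... | nothing = suc (flawsFrom n occ as)
... | just s  = flawsFrom n (s ∷ occ) as

flaws : ℕ → List ℕ → ℕ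
flaws n prefs = flawsFrom n [] prefs

Ordered : List ℕ → Set
Ordered = Linked _≤_

Counted : (n k l m : ℕ) → List ℕ → Set
Counted n k l m xs = Ordered xs × (head xs ≡ just m) × All (_≤ l) xs × (k ≤ flaws n xs)

open import Relation.Nullary using (Dec)
open import Relation.Nullary.Decidable using (_×-dec_)
open import Data.List.Relation.Unary.All using (all?)
open import Data.List.Relation.Unary.Linked using (linked?)
import Data.Maybe.Properties as MP
import Data.Nat as N

counted? : (n k l m : ℕ) → (xs : List ℕ) → Dec (Counted n k l m xs)
counted? n k l m xs =
  linked? N._≤?_ xs ×-dec (MP.≡-dec N._≟_ (head xs) (just m)
    ×-dec (all? (λ x → x ≤? l) xs ×-dec (k ≤? flaws n xs)))

op : (n k l m : ℕ) → ℕ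
op n k l m = length (filter (counted? n k l m) (PrefSets n))

-- An ordered preference list is parked from left to right, so the spots taken at or beyond the next
-- preference always form one block ending at the last spot taken, p: the next car, preferring a, parks at
-- max(a, p + 1) unless p = n. Hence an ordered list a₁ ≤ ⋯ ≤ aₙ has at least k flaws iff a_j ≥ k + j for
-- some j. Fixing a₁ = m, the tail is a sorted list with entries in [m, l] having such an entry. Splitting
-- these lists on whether their first entry equals the lower bound gives Pascal's recurrence in the lower
-- bound and the length, with the multiset numbers C(len + l − lo, len) as boundary values, and it is
-- solved by C(n + l − m − 1, l − k − 2).
module Submission where

open import Defs
open import Algebra.Properties.CommutativeSemigroup using (xy∙z≈xz∙y)
open import Data.Bool using (true; false)
open import Data.Bool.Properties using (T-≡)
open import Data.Empty using (⊥)
open import Data.List using (List; []; _∷_; _++_; map; concat; length; filter; upTo; applyUpTo)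
open import Data.List.Membership.Propositional using (_∈_)
open import Data.List.Membership.Propositional.Properties using (∈-map⁺; ∈-upTo⁺)
open import Data.List.Properties using (filter-++; length-++; filter-none; map-∘; map-cong; map-upTo)
open import Data.List.Relation.Unary.All as All using (All; []; _∷_; all?)
open import Data.List.Relation.Unary.All.Properties using (map⁺; concat⁺)
open import Data.List.Relation.Unary.Any using (here; there)
open import Data.List.Relation.Unary.Linked using (Linked; _∷_; linked?)
open import Data.List.Relation.Unary.Unique.Propositional using (Unique; _∷_)
import Data.List.Relation.Unary.Unique.Propositional.Properties as Unique
open import Data.Maybe using (just; nothing)
open import Data.Maybe.Properties using (just-injective)
open import Data.Nat using (ℕ; zero; suc; _+_; _∸_; _≤_; _<_; _≤?_; _<?_; _⊔_; _≡ᵇ_; z≤n; s≤s; s≤s⁻¹; z<s)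
open import Data.Nat.Combinatorics using (_C_; nCk≡nC[n∸k]; nCk+nC[k+1]≡[n+1]C[k+1]; k>n⇒nCk≡0)
open import Data.Nat.ListAction using (sum)
open import Data.Nat.Properties
open import Data.Product using (_×_; _,_; proj₁; proj₂)
open import Data.Product.Function.NonDependent.Propositional using (_×-⇔_)
open import Data.Sum using (_⊎_; inj₁; inj₂; [_,_]′)
open import Function using (_∘_; _⇔_; mk⇔; Equivalence)
open import Function.Properties.Equivalence using () renaming (refl to ⇔-refl; trans to ⇔-trans)
open import Level using (0ℓ)
open import Relation.Binary.PropositionalEquality
open import Relation.Nullary using (¬_; yes; no; contradiction)
open import Relation.Nullary.Decidable using (_×-dec_; _⊎-dec_)
open import Relation.Unary using (Pred; Decidable)
open import Relation.Unary.Properties using (∅?; ∁∅-Universal)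

open Equivalence using (to; from)

count : {A : Set} {P : Pred A 0ℓ} → Decidable P → List A → ℕ
count P? xs = length (filter P? xs)

module _ {A : Set} {P : Pred A 0ℓ} (P? : Decidable P) where

  count-++ : ∀ xs ys → count P? (xs ++ ys) ≡ count P? xs + count P? ys
  count-++ xs ys = trans (cong length (filter-++ P? xs ys)) (length-++ (filter P? xs))

  count-concat : ∀ xss → count P? (concat xss) ≡ sum (map (count P?) xss)
  count-concat []         = refl
  count-concat (xs ∷ xss) = trans (count-++ xs (concat xss)) (cong (count P? xs +_) (count-concat xss))

  count-none : ∀ {xs} → All (¬_ ∘ P) xs → count P? xs ≡ 0
  count-none ¬ps = cong length (filter-none P? ¬ps)

count-map : ∀ {A B : Set} {P : Pred B 0ℓ} (P? : Decidable P) (f : A → B) xs →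
  count P? (map f xs) ≡ count (P? ∘ f) xs
count-map P? f []       = refl
count-map P? f (x ∷ xs) with P? (f x)
... | yes _ = cong suc (count-map P? f xs)
... | no  _ = count-map P? f xs

count-cong-local : ∀ {A : Set} {P Q : Pred A 0ℓ} (P? : Decidable P) (Q? : Decidable Q) {xs} →
  All (λ x → P x ⇔ Q x) xs → count P? xs ≡ count Q? xs
count-cong-local P? Q? {[]}     []          = refl
count-cong-local P? Q? {x ∷ xs} (P⇔Q ∷ eqs) with P? x | Q? x
... | yes _  | yes _  = cong suc (count-cong-local P? Q? eqs)
... | no  _  | no  _  = count-cong-local P? Q? eqs
... | yes px | no ¬qx = contradiction (to P⇔Q px) ¬qx
... | no ¬px | yes qx = contradiction (from P⇔Q qx) ¬px

sum-map-cong-local : ∀ {A : Set} {f g : A → ℕ} {xs} → All (λ x → f x ≡ g x) xs →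
  sum (map f xs) ≡ sum (map g xs)
sum-map-cong-local []         = refl
sum-map-cong-local (eq ∷ eqs) = cong₂ _+_ eq (sum-map-cong-local eqs)

sum-map-update : ∀ {A : Set} {f g : A → ℕ} {a v xs} → Unique xs → a ∈ xs →
  (∀ {x} → x ≢ a → f x ≡ g x) → f a ≡ g a + v →
  sum (map f xs) ≡ sum (map g xs) + v
sum-map-update {f = f} {g} {a} {v} {a ∷ xs} (a∉xs ∷ _) (here refl) f≗g fa = begin
  f a + sum (map f xs)     ≡⟨ cong₂ _+_ fa (sum-map-cong-local (All.map (λ a≢x → f≗g (a≢x ∘ sym)) a∉xs)) ⟩
  g a + v + sum (map g xs) ≡⟨ xy∙z≈xz∙y +-commutativeSemigroup (g a) v _ ⟩
  g a + sum (map g xs) + v ∎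
  where open ≡-Reasoning
sum-map-update {f = f} {g} {v = v} {x ∷ xs} (x∉xs ∷ uniq) (there a∈xs) f≗g fa = begin
  f x + sum (map f xs)       ≡⟨ cong₂ _+_ (f≗g (All.lookup x∉xs a∈xs)) (sum-map-update uniq a∈xs f≗g fa) ⟩
  g x + (sum (map g xs) + v) ≡⟨ +-assoc (g x) _ v ⟨
  g x + sum (map g xs) + v   ∎
  where open ≡-Reasoning

range-∷ : ∀ {a b} → a ≤ b → range a b ≡ a ∷ range (suc a) b
range-∷ {a} {b} a≤b = begin
  map (a +_) (upTo (suc b ∸ a))              ≡⟨ cong (map (a +_) ∘ upTo) (+-∸-assoc 1 a≤b) ⟩
  a + 0 ∷ map (a +_) (applyUpTo suc (b ∸ a)) ≡⟨ cong₂ _∷_ (+-identityʳ a) (cong (map (a +_)) (sym (map-upTo suc _))) ⟩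
  a ∷ map (a +_) (map suc (upTo (b ∸ a)))    ≡⟨ cong (a ∷_) (map-∘ (upTo (b ∸ a))) ⟨
  a ∷ map ((a +_) ∘ suc) (upTo (b ∸ a))      ≡⟨ cong (a ∷_) (map-cong (+-suc a) (upTo (b ∸ a))) ⟩
  a ∷ map (suc a +_) (upTo (b ∸ a))          ∎
  where open ≡-Reasoning

range-[] : ∀ {a b} → b < a → range a b ≡ []
range-[] {a} b<a = cong (map (a +_) ∘ upTo) (m≤n⇒m∸n≡0 b<a)

∈-range⁺ : ∀ {a b x} → a ≤ x → x ≤ b → x ∈ range a b
∈-range⁺ {a} {b} {x} a≤x x≤b =
  subst (_∈ range a b) (m+[n∸m]≡n a≤x) (∈-map⁺ (a +_) (∈-upTo⁺ x∸a<1+b∸a))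
  where
  x∸a<1+b∸a : x ∸ a < suc b ∸ a
  x∸a<1+b∸a = subst (_≤ suc b ∸ a) (+-∸-assoc 1 a≤x) (∸-monoˡ-≤ a (s≤s x≤b))

range-unique : ∀ a b → Unique (range a b)
range-unique a b = Unique.map⁺ (+-cancelˡ-≡ a _ _) (Unique.upTo⁺ (suc b ∸ a))

allSeqs-length : ∀ len B → All (λ xs → length xs ≡ len) (allSeqs len B)
allSeqs-length zero      B = refl ∷ []
allSeqs-length (suc len) B =
  concat⁺ (map⁺ (All.universal (λ _ → map⁺ (All.map (cong suc) (allSeqs-length len B))) (range 1 B)))

count-allSeqs-suc : ∀ {P : Pred (List ℕ) 0ℓ} (P? : Decidable P) len B → count P? (allSeqs (suc len) B) ≡
  sum (map (λ x → count (P? ∘ (x ∷_)) (allSeqs len B)) (range 1 B))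
count-allSeqs-suc P? len B = begin
  count P? (concat (map withHead (range 1 B)))                ≡⟨ count-concat P? (map withHead (range 1 B)) ⟩
  sum (map (count P?) (map withHead (range 1 B)))             ≡⟨ cong sum (map-∘ (range 1 B)) ⟨
  sum (map (count P? ∘ withHead) (range 1 B))
    ≡⟨ cong sum (map-cong (λ x → count-map P? (x ∷_) (allSeqs len B)) (range 1 B)) ⟩
  sum (map (λ x → count (P? ∘ (x ∷_)) (allSeqs len B)) (range 1 B)) ∎
  where
  open ≡-Reasoning
  withHead : ℕ → List (List ℕ)
  withHead x = map (x ∷_) (allSeqs len B)

module _ {P Q R : Pred (List ℕ) 0ℓ} (P? : Decidable P) (Q? : Decidable Q) (R? : Decidable R) where

  count-allSeqs-splitHead : ∀ {len B lo} → 1 ≤ lo → lo ≤ B →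
    (∀ {x ys} → length ys ≡ len → x ≢ lo → P (x ∷ ys) ⇔ Q (x ∷ ys)) →
    (∀ {ys} → length ys ≡ len → P (lo ∷ ys) ⇔ R ys) →
    (∀ {ys} → ¬ Q (lo ∷ ys)) →
    count P? (allSeqs (suc len) B) ≡ count Q? (allSeqs (suc len) B) + count R? (allSeqs len B)
  count-allSeqs-splitHead {len} {B} {lo} 1≤lo lo≤B P⇔Q P⇔R ¬Q = begin
    count P? (allSeqs (suc len) B)                       ≡⟨ count-allSeqs-suc P? len B ⟩
    sum (map (countWithHead P?) (range 1 B))             ≡⟨ sum-map-update (range-unique 1 B) (∈-range⁺ 1≤lo lo≤B)
                                                              awayFromLo atLo ⟩
    sum (map (countWithHead Q?) (range 1 B)) + count R? L ≡⟨ cong (_+ count R? L) (count-allSeqs-suc Q? len B) ⟨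
    count Q? (allSeqs (suc len) B) + count R? L          ∎
    where
    open ≡-Reasoning
    L = allSeqs len B
    countWithHead : {S : Pred (List ℕ) 0ℓ} → Decidable S → ℕ → ℕ
    countWithHead S? x = count (S? ∘ (x ∷_)) L
    awayFromLo : ∀ {x} → x ≢ lo → countWithHead P? x ≡ countWithHead Q? x
    awayFromLo x≢lo = count-cong-local _ _ (All.map (λ len≡ → P⇔Q len≡ x≢lo) (allSeqs-length len B))
    atLo : countWithHead P? lo ≡ countWithHead Q? lo + count R? L
    atLo = begin
      countWithHead P? lo              ≡⟨ count-cong-local _ _ (All.map P⇔R (allSeqs-length len B)) ⟩
      count R? L                       ≡⟨ cong (_+ count R? L) (count-none _ (All.universal (λ _ → ¬Q) L)) ⟨
      countWithHead Q? lo + count R? L ∎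

SortedBetween : ℕ → ℕ → List ℕ → Set
SortedBetween lo hi ys = Linked _≤_ (lo ∷ ys) × All (_≤ hi) ys

sortedBetween? : ∀ lo hi → Decidable (SortedBetween lo hi)
sortedBetween? lo hi ys = linked? _≤?_ (lo ∷ ys) ×-dec all? (_≤? hi) ys

module _ {lo hi : ℕ} where

  sortedBetween-head : lo ≤ hi → ∀ {ys} → SortedBetween lo hi (lo ∷ ys) ⇔ SortedBetween lo hi ys
  sortedBetween-head lo≤hi = mk⇔ (λ { (_ ∷ sorted , _ ∷ ys≤hi) → sorted , ys≤hi })
                                 (λ (sorted , ys≤hi) → ≤-refl ∷ sorted , lo≤hi ∷ ys≤hi)

  sortedBetween-suc : ∀ {x ys} → x ≢ lo → SortedBetween lo hi (x ∷ ys) ⇔ SortedBetween (suc lo) hi (x ∷ ys)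
  sortedBetween-suc x≢lo = mk⇔ (λ { (lo≤x ∷ sorted , all) → ≤∧≢⇒< lo≤x (x≢lo ∘ sym) ∷ sorted , all })
                               (λ { (lo<x ∷ sorted , all) → <⇒≤ lo<x ∷ sorted , all })

  sortedBetween-lower : ∀ {x ys} → SortedBetween lo hi (x ∷ ys) → lo ≤ x
  sortedBetween-lower (lo≤x ∷ _ , _) = lo≤x

  sortedBetween-upper : ∀ {x ys} → SortedBetween lo hi (x ∷ ys) → x ≤ hi
  sortedBetween-upper (_ , x≤hi ∷ _) = x≤hi

-- ExceedsFrom k (a₁ ∷ a₂ ∷ ⋯) says that a_j ≥ k + j for some j.
ExceedsFrom : ℕ → List ℕ → Set
ExceedsFrom c []       = ⊥
ExceedsFrom c (y ∷ ys) = c < y ⊎ ExceedsFrom (suc c) ys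

exceedsFrom? : ∀ c → Decidable (ExceedsFrom c)
exceedsFrom? c []       = no λ ()
exceedsFrom? c (y ∷ ys) = c <? y ⊎-dec exceedsFrom? (suc c) ys

exceedsFrom⇒< : ∀ {n c ys} → All (_≤ n) ys → ExceedsFrom c ys → c < n
exceedsFrom⇒< (y≤n ∷ _)  (inj₁ c<y) = <-≤-trans c<y y≤n
exceedsFrom⇒< (_ ∷ ys≤n) (inj₂ ex)  = <-trans (n<1+n _) (exceedsFrom⇒< ys≤n ex)

exceedsFrom-∷-≤ : ∀ {c y ys} → y ≤ c → ExceedsFrom c (y ∷ ys) ⇔ ExceedsFrom (suc c) ys
exceedsFrom-∷-≤ y≤c = mk⇔ (λ { (inj₁ c<y) → contradiction y≤c (<⇒≱ c<y) ; (inj₂ ex) → ex }) inj₂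

SortedExceeding : ℕ → ℕ → ℕ → List ℕ → Set
SortedExceeding lo hi c ys = SortedBetween lo hi ys × ExceedsFrom c ys

sortedExceeding? : ∀ lo hi c → Decidable (SortedExceeding lo hi c)
sortedExceeding? lo hi c ys = sortedBetween? lo hi ys ×-dec exceedsFrom? c ys

-- Counting sorted sequences

nC[k+1]+nCk≡[n+1]C[k+1] : ∀ n k → n C suc k + n C k ≡ suc n C suc k
nC[k+1]+nCk≡[n+1]C[k+1] n k = trans (+-comm (n C suc k) (n C k)) (nCk+nC[k+1]≡[n+1]C[k+1] n k)

[a+b]Ca≡[a+b]Cb : ∀ a b {n} → a + b ≡ n → n C a ≡ n C b
[a+b]Ca≡[a+b]Cb a b refl = trans (nCk≡nC[n∸k] (m≤m+n a b)) (cong ((a + b) C_) (m+n∸m≡n a b))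

count-sortedBetween : ∀ {hi B} len d {lo} → lo + d ≡ suc hi → 1 ≤ lo → hi ≤ B →
  count (sortedBetween? lo hi) (allSeqs len B) ≡ (len + hi ∸ lo) C len
count-sortedBetween zero d eq 1≤lo hi≤B = refl
count-sortedBetween {hi} {B} (suc len) zero {lo} eq 1≤lo hi≤B
  with refl ← trans (sym (+-identityʳ lo)) eq = begin
  count (sortedBetween? (suc hi) hi) (allSeqs (suc len) B) ≡⟨ count-none _ (All.map noneSorted (allSeqs-length (suc len) B)) ⟩
  0                                                       ≡⟨ k>n⇒nCk≡0 (n<1+n len) ⟨
  len C suc len                                           ≡⟨ cong (_C suc len) (m+n∸n≡m len hi) ⟨
  (len + hi ∸ hi) C suc len                               ∎
  where
  open ≡-Reasoning
  noneSorted : ∀ {ys} → length ys ≡ suc len → ¬ SortedBetween (suc hi) hi ys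
  noneSorted {x ∷ ys} _ sorted = <⇒≱ (sortedBetween-lower sorted) (sortedBetween-upper sorted)
count-sortedBetween {hi} {B} (suc len) (suc d) {lo} eq 1≤lo hi≤B = begin
  count (sortedBetween? lo hi) (allSeqs (suc len) B)
    ≡⟨ count-allSeqs-splitHead (sortedBetween? lo hi) (sortedBetween? (suc lo) hi) (sortedBetween? lo hi) {len}
         1≤lo (≤-trans lo≤hi hi≤B) (λ _ → sortedBetween-suc) (λ _ → sortedBetween-head lo≤hi)
         (λ sorted → <-irrefl refl (sortedBetween-lower sorted)) ⟩
  count (sortedBetween? (suc lo) hi) (allSeqs (suc len) B) + count (sortedBetween? lo hi) (allSeqs len B)
    ≡⟨ cong₂ _+_ (count-sortedBetween (suc len) d (trans (sym (+-suc lo d)) eq) (m≤n⇒m≤1+n 1≤lo) hi≤B)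
                 (count-sortedBetween len (suc d) eq 1≤lo hi≤B) ⟩
  (len + hi ∸ lo) C suc len + (len + hi ∸ lo) C len
    ≡⟨ nC[k+1]+nCk≡[n+1]C[k+1] (len + hi ∸ lo) len ⟩
  suc (len + hi ∸ lo) C suc len
    ≡⟨ cong (_C suc len) (+-∸-assoc 1 (≤-trans lo≤hi (m≤n+m hi len))) ⟨
  (suc len + hi ∸ lo) C suc len ∎
  where
  open ≡-Reasoning
  lo≤hi : lo ≤ hi
  lo≤hi = subst (lo ≤_) (suc-injective (trans (sym (+-suc lo d)) eq)) (m≤m+n lo d)

count-sortedExceeding-vanish : ∀ {lo hi c} → hi ≤ c → ∀ xss → count (sortedExceeding? lo hi c) xss ≡ 0
count-sortedExceeding-vanish hi≤c xss = count-none _ (All.universal noneExceeding xss)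
  where
  noneExceeding : ∀ ys → ¬ SortedExceeding _ _ _ ys
  noneExceeding ys (sorted , ex) = <⇒≱ (exceedsFrom⇒< (proj₂ sorted) ex) hi≤c

count-sortedExceeding : ∀ {hi B} len d {lo c} → lo + d ≡ suc c → 1 ≤ lo → c < hi → hi ≤ len + c → hi ≤ B →
  count (sortedExceeding? lo hi c) (allSeqs len B) ≡ (len + hi ∸ lo) C (hi ∸ suc c)
count-sortedExceeding zero d _ _ c<hi hi≤c _ = contradiction hi≤c (<⇒≱ c<hi)
count-sortedExceeding {hi} {B} (suc len) zero {lo} {c} eq 1≤lo c<hi _ hi≤B
  with refl ← trans (sym (+-identityʳ lo)) eq = begin
  count (sortedExceeding? (suc c) hi c) (allSeqs (suc len) B)
    ≡⟨ count-cong-local _ _ (All.map exceedsForFree (allSeqs-length (suc len) B)) ⟩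
  count (sortedBetween? (suc c) hi) (allSeqs (suc len) B)
    ≡⟨ count-sortedBetween (suc len) (hi ∸ c) (cong suc (m+[n∸m]≡n (<⇒≤ c<hi))) 1≤lo hi≤B ⟩
  (len + hi ∸ c) C suc len
    ≡⟨ [a+b]Ca≡[a+b]Cb (suc len) (hi ∸ suc c) lengths ⟩
  (len + hi ∸ c) C (hi ∸ suc c) ∎
  where
  open ≡-Reasoning
  exceedsForFree : ∀ {ys} → length ys ≡ suc len → SortedExceeding (suc c) hi c ys ⇔ SortedBetween (suc c) hi ys
  exceedsForFree {y ∷ ys} _ = mk⇔ proj₁ (λ sorted → sorted , inj₁ (sortedBetween-lower sorted))
  lengths : suc len + (hi ∸ suc c) ≡ len + hi ∸ c
  lengths = begin
    suc len + (hi ∸ suc c) ≡⟨ +-suc len (hi ∸ suc c) ⟨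
    len + suc (hi ∸ suc c) ≡⟨ cong (len +_) (+-∸-assoc 1 c<hi) ⟨
    len + (hi ∸ c)         ≡⟨ +-∸-assoc len (<⇒≤ c<hi) ⟨
    len + hi ∸ c           ∎
count-sortedExceeding {hi} {B} (suc len) (suc d) {lo} {c} eq 1≤lo c<hi hi≤len+c hi≤B = begin
  count (sortedExceeding? lo hi c) (allSeqs (suc len) B)
    ≡⟨ count-allSeqs-splitHead (sortedExceeding? lo hi c) (sortedExceeding? (suc lo) hi c) (sortedExceeding? lo hi (suc c))
         {len} 1≤lo (≤-trans lo≤hi hi≤B)
         (λ _ x≢lo → sortedBetween-suc x≢lo ×-⇔ ⇔-refl)
         (λ _ → sortedBetween-head lo≤hi ×-⇔ exceedsFrom-∷-≤ lo≤c)
         (λ (sorted , _) → <-irrefl refl (sortedBetween-lower sorted)) ⟩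
  count (sortedExceeding? (suc lo) hi c) (allSeqs (suc len) B) + rest
    ≡⟨ cong (_+ rest) (count-sortedExceeding (suc len) d (trans (sym (+-suc lo d)) eq) (m≤n⇒m≤1+n 1≤lo)
                                             c<hi hi≤len+c hi≤B) ⟩
  N C (hi ∸ suc c) + rest
    ≡⟨ pascal ⟩
  suc N C (hi ∸ suc c)
    ≡⟨ cong (_C (hi ∸ suc c)) (+-∸-assoc 1 (≤-trans lo≤hi (m≤n+m hi len))) ⟨
  (suc len + hi ∸ lo) C (hi ∸ suc c) ∎
  where
  open ≡-Reasoning
  N = len + hi ∸ lo
  rest = count (sortedExceeding? lo hi (suc c)) (allSeqs len B)
  lo≤c : lo ≤ c
  lo≤c = subst (lo ≤_) (suc-injective (trans (sym (+-suc lo d)) eq)) (m≤m+n lo d)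
  lo≤hi : lo ≤ hi
  lo≤hi = ≤-trans lo≤c (<⇒≤ c<hi)
  pascal : N C (hi ∸ suc c) + rest ≡ suc N C (hi ∸ suc c)
  pascal with suc c <? hi
  ... | no 1+c≮hi
    rewrite m≤n⇒m∸n≡0 (≮⇒≥ 1+c≮hi) | count-sortedExceeding-vanish {lo} (≮⇒≥ 1+c≮hi) (allSeqs len B) = refl
  ... | yes 1+c<hi rewrite +-∸-assoc 1 1+c<hi =
    trans (cong (N C suc (hi ∸ suc (suc c)) +_)
                (count-sortedExceeding len (suc (suc d)) (trans (+-suc lo (suc d)) (cong suc eq)) 1≤lo 1+c<hi
                                       (subst (hi ≤_) (sym (+-suc len c)) hi≤len+c) hi≤B))
          (nC[k+1]+nCk≡[n+1]C[k+1] N (hi ∸ suc (suc c)))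

-- Parking an ordered preference list

firstNotIn-skip : ∀ occ {x} xs → elemᵇ x occ ≡ true → firstNotIn occ (x ∷ xs) ≡ firstNotIn occ xs
firstNotIn-skip occ xs x∈occ rewrite x∈occ = refl

firstNotIn-stop : ∀ occ {x} xs → elemᵇ x occ ≡ false → firstNotIn occ (x ∷ xs) ≡ just x
firstNotIn-stop occ xs x∉occ rewrite x∉occ = refl

module _ {occ : List ℕ} {b : ℕ} where

  firstNotIn-occupied : ∀ {a} → a ≤ b → (∀ {x} → a ≤ x → x ≤ b → elemᵇ x occ ≡ true) →
    firstNotIn occ (range a b) ≡ nothing
  firstNotIn-occupied {a} a≤b = go (suc b ∸ a) (m∸n+n≡m (m≤n⇒m≤1+n a≤b))
    where
    go : ∀ t {a} → t + a ≡ suc b → (∀ {x} → a ≤ x → x ≤ b → elemᵇ x occ ≡ true) →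
      firstNotIn occ (range a b) ≡ nothing
    go zero    refl _ = cong (firstNotIn occ) (range-[] (n<1+n b))
    go (suc t) {a} eq occupied = begin
      firstNotIn occ (range a b)           ≡⟨ cong (firstNotIn occ) (range-∷ a≤b′) ⟩
      firstNotIn occ (a ∷ range (suc a) b) ≡⟨ firstNotIn-skip occ (range (suc a) b) (occupied ≤-refl a≤b′) ⟩
      firstNotIn occ (range (suc a) b)     ≡⟨ go t (trans (+-suc t a) eq) (occupied ∘ <⇒≤) ⟩
      nothing                              ∎
      where
      open ≡-Reasoning
      a≤b′ : a ≤ b
      a≤b′ = subst (a ≤_) (suc-injective eq) (m≤n+m a t)

  firstNotIn-free : ∀ {a q} → a ≤ q → q ≤ b → elemᵇ q occ ≡ false →
    (∀ {x} → a ≤ x → x < q → elemᵇ x occ ≡ true) → firstNotIn occ (range a b) ≡ just q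
  firstNotIn-free {a} {q} a≤q q≤b q∉occ = go (q ∸ a) (m∸n+n≡m a≤q)
    where
    go : ∀ d {a} → d + a ≡ q → (∀ {x} → a ≤ x → x < q → elemᵇ x occ ≡ true) →
      firstNotIn occ (range a b) ≡ just q
    go zero    refl _ = trans (cong (firstNotIn occ) (range-∷ q≤b)) (firstNotIn-stop occ (range (suc q) b) q∉occ)
    go (suc d) {a} eq occupied = begin
      firstNotIn occ (range a b)           ≡⟨ cong (firstNotIn occ) (range-∷ (≤-trans (<⇒≤ a<q) q≤b)) ⟩
      firstNotIn occ (a ∷ range (suc a) b) ≡⟨ firstNotIn-skip occ (range (suc a) b) (occupied ≤-refl a<q) ⟩
      firstNotIn occ (range (suc a) b)     ≡⟨ go d (trans (+-suc d a) eq) (occupied ∘ <⇒≤) ⟩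
      just q                               ∎
      where
      open ≡-Reasoning
      a<q : a < q
      a<q = subst (a <_) eq (s≤s (m≤n+m a d))

elemᵇ-∷-self : ∀ s occ → elemᵇ s (s ∷ occ) ≡ true
elemᵇ-∷-self s occ rewrite to T-≡ (≡⇒≡ᵇ s s refl) = refl

elemᵇ-∷-≢ : ∀ {s q} occ → s ≢ q → elemᵇ s (q ∷ occ) ≡ elemᵇ s occ
elemᵇ-∷-≢ {s} {q} occ s≢q with s ≡ᵇ q in s≡ᵇq
... | true  = contradiction (≡ᵇ⇒≡ s q (from T-≡ s≡ᵇq)) s≢q
... | false = refl

≤-⊔⁻ : ∀ {m a b} → m ≤ a ⊔ b → m ≤ a ⊎ m ≤ b
≤-⊔⁻ {m} {a} {b} m≤a⊔b with ⊔-sel a b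
... | inj₁ a⊔b≡a = inj₁ (subst (m ≤_) a⊔b≡a m≤a⊔b)
... | inj₂ a⊔b≡b = inj₂ (subst (m ≤_) a⊔b≡b m≤a⊔b)

-- Spots lo, …, p are taken and no spot beyond p is: all that a car preferring some a ≥ lo can see.
record Frontier (lo p : ℕ) (occ : List ℕ) : Set where
  field
    occupied : ∀ {s} → lo ≤ s → s ≤ p → elemᵇ s occ ≡ true
    free     : ∀ {s} → p < s → elemᵇ s occ ≡ false

module _ {lo p occ} (frontier : Frontier lo p occ) where
  open Frontier frontier

  frontier-raise : ∀ {a} → lo ≤ a → Frontier a p occ
  frontier-raise lo≤a = record { occupied = occupied ∘ ≤-trans lo≤a ; free = free }

  frontier-park : ∀ {a} → lo ≤ a → Frontier a (a ⊔ suc p) (a ⊔ suc p ∷ occ)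
  frontier-park {a} lo≤a = record { occupied = occupied′ ; free = free′ }
    where
    q = a ⊔ suc p
    occupied′ : ∀ {s} → a ≤ s → s ≤ q → elemᵇ s (q ∷ occ) ≡ true
    occupied′ {s} a≤s s≤q with s ≟ q
    ... | yes refl = elemᵇ-∷-self s occ
    ... | no  s≢q with ≤-⊔⁻ (≤∧≢⇒< s≤q s≢q)
    ...   | inj₁ s<a   = contradiction a≤s (<⇒≱ s<a)
    ...   | inj₂ s<1+p = trans (elemᵇ-∷-≢ occ s≢q) (occupied (≤-trans lo≤a a≤s) (s≤s⁻¹ s<1+p))
    free′ : ∀ {s} → q < s → elemᵇ s (q ∷ occ) ≡ false
    free′ q<s = trans (elemᵇ-∷-≢ occ (λ { refl → <-irrefl refl q<s }))
                      (free (<⇒≤ (≤-<-trans (m≤n⊔m a (suc p)) q<s)))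

  parkSpot-full : ∀ {n a} → lo ≤ a → a ≤ n → n ≤ p → parkSpot n occ a ≡ nothing
  parkSpot-full lo≤a a≤n n≤p =
    firstNotIn-occupied a≤n (λ a≤x x≤n → occupied (≤-trans lo≤a a≤x) (≤-trans x≤n n≤p))

  parkSpot-next : ∀ {n a} → lo ≤ a → a ≤ n → p < n → parkSpot n occ a ≡ just (a ⊔ suc p)
  parkSpot-next {n} {a} lo≤a a≤n p<n =
    firstNotIn-free (m≤m⊔n a (suc p)) (⊔-lub a≤n p<n) (free (m≤n⊔m a (suc p))) occupiedBelow
    where
    occupiedBelow : ∀ {x} → a ≤ x → x < a ⊔ suc p → elemᵇ x occ ≡ true
    occupiedBelow a≤x x<q with ≤-⊔⁻ x<q
    ... | inj₁ x<a   = contradiction a≤x (<⇒≱ x<a)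
    ... | inj₂ x<1+p = occupied (≤-trans lo≤a a≤x) (s≤s⁻¹ x<1+p)

-- Parking an ordered list only needs the last spot taken, p: the next car takes a ⊔ suc p unless p ≥ n.
flawsAfter : ℕ → ℕ → List ℕ → ℕ
flawsAfter n p []       = 0
flawsAfter n p (a ∷ as) with n ≤? p
... | yes _ = suc (flawsAfter n p as)
... | no  _ = flawsAfter n (a ⊔ suc p) as

flawsFrom-frontier : ∀ {n lo p occ ys} → Frontier lo p occ → SortedBetween lo n ys →
  flawsFrom n occ ys ≡ flawsAfter n p ys
flawsFrom-frontier {ys = []} _ _ = refl
flawsFrom-frontier {n} {p = p} {ys = a ∷ as} frontier (lo≤a ∷ sorted , a≤n ∷ as≤n) with n ≤? p
... | yes n≤p rewrite parkSpot-full frontier lo≤a a≤n n≤p =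
  cong suc (flawsFrom-frontier (frontier-raise frontier lo≤a) (sorted , as≤n))
... | no  n≰p rewrite parkSpot-next frontier lo≤a a≤n (≰⇒> n≰p) =
  flawsFrom-frontier (frontier-park frontier lo≤a) (sorted , as≤n)

flawsAfter-full : ∀ {n p} → n ≤ p → ∀ ys → flawsAfter n p ys ≡ length ys
flawsAfter-full         n≤p []       = refl
flawsAfter-full {n} {p} n≤p (a ∷ as) with n ≤? p
... | yes _   = cong suc (flawsAfter-full n≤p as)
... | no  n≰p = contradiction n≤p n≰p

+-≡⇒≤⇔≥ : ∀ {a b c d} → a + b ≡ c + d → a ≤ c ⇔ d ≤ b
+-≡⇒≤⇔≥ {a} {b} {c} {d} eq = mk⇔
  (λ a≤c → +-cancelˡ-≤ c d b (subst (_≤ c + b) eq (+-monoˡ-≤ b a≤c)))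
  (λ d≤b → +-cancelʳ-≤ b a c (subst (_≤ c + b) (sym eq) (+-monoʳ-≤ c d≤b)))

flawsAfter-exceedsFrom : ∀ {n p c r} ys → p ≤ n → All (_≤ n) ys → c + length ys ≡ n + suc r →
  r < flawsAfter n p ys ⇔ (c ≤ p ⊎ ExceedsFrom c ys)
flawsAfter-exceedsFrom {n} {p} {c} {r} [] p≤n _ eq = mk⇔ (λ ()) λ
  { (inj₁ c≤p) → contradiction (≤-trans c≤p p≤n)
                   (<⇒≱ (subst (n <_) (sym (trans (sym (+-identityʳ c)) eq)) (m<m+n n z<s)))
  ; (inj₂ ()) }
flawsAfter-exceedsFrom {n} {p} {c} {r} (a ∷ as) p≤n (a≤n ∷ as≤n) eq with n ≤? p
... | yes n≤p rewrite flawsAfter-full n≤p as = mk⇔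
  (λ r<1+as → inj₁ (≤-trans (from (+-≡⇒≤⇔≥ eq) r<1+as) n≤p))
  λ { (inj₁ c≤p) → to (+-≡⇒≤⇔≥ eq) (≤-trans c≤p p≤n)
    ; (inj₂ ex)  → to (+-≡⇒≤⇔≥ eq) (<⇒≤ (exceedsFrom⇒< (a≤n ∷ as≤n) ex)) }
... | no  n≰p = ⇔-trans
  (flawsAfter-exceedsFrom as (⊔-lub a≤n (≰⇒> n≰p)) as≤n (trans (sym (+-suc c (length as))) eq))
  (mk⇔ (λ { (inj₁ c<q) → [ inj₂ ∘ inj₁ , inj₁ ∘ s≤s⁻¹ ]′ (≤-⊔⁻ c<q) ; (inj₂ ex) → inj₂ (inj₂ ex) })
       λ { (inj₁ c≤p)         → inj₁ (m≤n⇒m≤o⊔n a (s≤s c≤p))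
         ; (inj₂ (inj₁ c<a))  → inj₁ (m≤n⇒m≤n⊔o (suc p) c<a)
         ; (inj₂ (inj₂ ex))   → inj₂ ex })

<-flaws⇔exceedsFrom : ∀ {n r xs} → SortedBetween 1 n xs → length xs ≡ n →
  r < flaws n xs ⇔ ExceedsFrom (suc r) xs
<-flaws⇔exceedsFrom {n} {r} {xs} sorted refl = ⇔-trans
  (subst (λ f → r < flaws n xs ⇔ r < f) (flawsFrom-frontier emptyFrontier sorted) ⇔-refl)
  (⇔-trans (flawsAfter-exceedsFrom xs z≤n (proj₂ sorted) (+-comm (suc r) n))
           (mk⇔ (λ { (inj₁ ()) ; (inj₂ ex) → ex }) inj₂))
  where
  emptyFrontier : Frontier 1 0 []
  emptyFrontier = record { occupied = λ 1≤s s≤0 → contradiction s≤0 (<⇒≱ 1≤s) ; free = λ _ → refl }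

module _ {n k l m : ℕ} (1≤m : 1 ≤ m) (m≤k : m ≤ suc k) (k<l : suc k < l) (l≤n : l ≤ suc n) where

  private
    m≤l : m ≤ l
    m≤l = ≤-trans m≤k (<⇒≤ k<l)

  counted∷⇔sortedExceeding : ∀ {ys} → length ys ≡ n →
    Counted (suc n) (suc k) l m (m ∷ ys) ⇔ SortedExceeding m l (suc (suc k)) ys
  counted∷⇔sortedExceeding {ys} len = mk⇔
    (λ { (sorted , _ , (_ ∷ ys≤l) , flawed) →
           (sorted , ys≤l) , to (exceedsFrom-∷-≤ m≤k) (to (flawed⇔ sorted ys≤l) flawed) })
    (λ { ((sorted , ys≤l) , ex) → sorted , refl , (m≤l ∷ ys≤l) , from (flawed⇔ sorted ys≤l) (inj₂ ex) })
    where
    flawed⇔ : Linked _≤_ (m ∷ ys) → All (_≤ l) ys → k < flaws (suc n) (m ∷ ys) ⇔ ExceedsFrom (suc k) (m ∷ ys)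
    flawed⇔ sorted ys≤l =
      <-flaws⇔exceedsFrom (1≤m ∷ sorted , All.map (λ x≤l → ≤-trans x≤l l≤n) (m≤l ∷ ys≤l)) (cong suc len)

  op≡count-sortedExceeding : op (suc n) (suc k) l m ≡ count (sortedExceeding? m l (suc (suc k))) (allSeqs n (suc n))
  op≡count-sortedExceeding = begin
    op (suc n) (suc k) l m
      ≡⟨ count-allSeqs-splitHead (counted? (suc n) (suc k) l m) ∅? (sortedExceeding? m l (suc (suc k))) {n}
           1≤m (≤-trans m≤l l≤n) (λ _ x≢m → mk⇔ (λ (_ , head≡ , _) → x≢m (just-injective head≡)) λ ())
           counted∷⇔sortedExceeding (λ ()) ⟩
    count ∅? (allSeqs (suc n) (suc n)) + tailCount
      ≡⟨ cong (_+ tailCount) (count-none ∅? (All.universal ∁∅-Universal (allSeqs (suc n) (suc n)))) ⟩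
    tailCount ∎
    where
    open ≡-Reasoning
    tailCount = count (sortedExceeding? m l (suc (suc k))) (allSeqs n (suc n))

-- Imported this late because the prefix +_ of ℤ would clash with the sections (n +_) above.
open import Data.Integer using (ℤ; +_; _-_)
import Data.Integer as ℤ
open import Data.Integer.Properties using ([+m]-[+n]≡m⊖n; ⊖-≥; ⊖-<; pos-+)
open import Data.Integer.Tactic.RingSolver using (solve-∀)

[+m]-[+n]≡+[m∸n] : ∀ {m n} → n ≤ m → + m - + n ≡ + (m ∸ n)
[+m]-[+n]≡+[m∸n] {m} {n} n≤m = trans ([+m]-[+n]≡m⊖n m n) (⊖-≥ n≤m)

[i-j]-k≡i-[k+j] : ∀ (i j k : ℤ) → (i - j) - k ≡ i - (k ℤ.+ j)
[i-j]-k≡i-[k+j] = solve-∀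

binomℤ-neg : ∀ N {a b} → a < b → binomℤ N (+ a - + b) ≡ 0
binomℤ-neg N {a} {suc b} (s≤s a≤b) rewrite [+m]-[+n]≡m⊖n a (suc b) | ⊖-< (s≤s a≤b) | +-∸-assoc 1 a≤b = refl

count-sortedExceeding-binomℤ : ∀ {hi B} len {lo c} → 1 ≤ lo → lo ≤ suc c → hi ≤ len + c → hi ≤ B →
  count (sortedExceeding? lo hi c) (allSeqs len B) ≡ binomℤ (len + hi ∸ lo) (+ hi - + suc c)
count-sortedExceeding-binomℤ {hi} {B} len {lo} {c} 1≤lo lo≤1+c hi≤len+c hi≤B with suc c ≤? hi
... | yes c<hi = trans (count-sortedExceeding len (suc c ∸ lo) (m+[n∸m]≡n lo≤1+c) 1≤lo c<hi hi≤len+c hi≤B)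
                       (sym (cong (binomℤ (len + hi ∸ lo)) ([+m]-[+n]≡+[m∸n] c<hi)))
... | no  c≮hi = trans (count-sortedExceeding-vanish (s≤s⁻¹ (≰⇒> c≮hi)) (allSeqs len B))
                       (sym (binomℤ-neg (len + hi ∸ lo) (≰⇒> c≮hi)))

mainTheorem20 : (n k l m : ℕ) → 1 ≤ m → m ≤ k → k + 1 ≤ l → l ≤ n →
    op n k l m ≡ binomℤ (n + l ∸ m ∸ 1) ((+ l - + k) - + 2)
mainTheorem20 zero    k       l m _   _   k+1≤l l≤0 = contradiction l≤0 (<⇒≱ (≤-trans (m≤n+m 1 k) k+1≤l))
mainTheorem20 (suc n) zero    l m 1≤m m≤0 _     _   = contradiction m≤0 (<⇒≱ 1≤m)
mainTheorem20 (suc n) (suc k) l m 1≤m m≤k k+1≤l l≤n = begin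
  op (suc n) (suc k) l m
    ≡⟨ op≡count-sortedExceeding 1≤m m≤k k<l l≤n ⟩
  count (sortedExceeding? m l (2 + k)) (allSeqs n (suc n))
    ≡⟨ count-sortedExceeding-binomℤ n 1≤m (≤-trans m≤k (m≤n+m (suc k) 2))
         (≤-trans l≤n (subst (suc n ≤_) (sym (+-suc n (suc k))) (s≤s (m≤m+n n (suc k))))) l≤n ⟩
  binomℤ (n + l ∸ m) (+ l - + (3 + k))
    ≡⟨ cong₂ binomℤ (trans (∸-+-assoc (suc n + l) m 1) (cong (suc n + l ∸_) (+-comm m 1)))
                    (trans ([i-j]-k≡i-[k+j] (+ l) (+ suc k) (+ 2)) (cong (λ j → + l - j) (sym (pos-+ 2 (suc k))))) ⟨
  binomℤ (suc n + l ∸ m ∸ 1) ((+ l - + suc k) - + 2)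
    ∎
  where
  open ≡-Reasoning
  k<l : suc k < l
  k<l = subst (_≤ l) (+-comm (suc k) 1) k+1≤l
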